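{- Let $r\geq2$, $k\geq1$ and $d\geq r+k$ be integers. Suppose $S_1,S_2,\dots,S_r\subseteq V(Q_{d-k})$ and $\ell_0:V(Q_k)\to\{0,1,\dots,r\}$ satisfy: (a) $S_i$ percolates with respect to the $i$-neighbour bootstrap process on $Q_{d-k}$ for all $1\leq i\leq r$; (b) $\ell_0$ percolates with respect to the $r$-meta bootstrap process on $Q_k$; (c) $S_1\subseteq S_2\subseteq\cdots\subseteq S_{r-1}$. Then the set \[A_0:=\bigcup_{i=1}^r\ \bigcup_{x\in\ell_0^{ -1}(i)}S_i^x\] percolates with respect to the $r$-neighbour bootstrap process on $Q_d$. Consequently, \[m(Q_d;r)\leq \sum_{i=1}^r|\ell_0^{ -1}(i)|\cdot |S_i|.\]
   Context: $Q_d$ denotes the $d$-dimensional hypercube: vertex set $\{0,1\}^d$, two vertices adjacent iff they differ in exactly one coordinate. For a graph $G$ and $r\geq1$, the $r$-neighbour bootstrap process on $G$ starts with a set $A_0\subseteq V(G)$ and sets $A_t:=A_{t-1}\cup\{v: |N_G(v)\cap A_{t-1}|\geq r\}$ for $t\geq1$; $A_0$ percolates if $\bigcup_t A_t=V(G)$; $m(G;r)$ is the minimum size of a percolating set. The $r$-meta bootstrap process on $G$ starts with a labeling $\ell_0:V(G)\to\{0,\dots,r\}$ which is updated by two rules until neither applies: (Completion) if a vertex of label $i$ has at least $r-i$ neighbours of label $r$, its label becomes $r$; (Promotion) if a vertex $v$ has at least $r$ neighbours whose labels are higher than that of $v$, the label of $v$ becomes the $r$-th highest label among its neighbours. (The final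 labeling does not depend on the order of rule applications.) A labeling percolates under the $r$-meta bootstrap process if every vertex eventually receives label $r$. For $S\subseteq V(Q_{d-k})$ and $x\in V(Q_k)$, $S^x\subseteq V(Q_d)$ denotes the set obtained by prefixing each vector of $S$ with $x$. -}

module Defs where

open import Data.Bool using (Bool; true; false; _∧_; _∨_; if_then_else_; not)
open import Data.Nat using (ℕ; zero; suc; _+_; _*_; _∸_; _≤_; _<_; _≤ᵇ_; _<ᵇ_; _≡ᵇ_)
open import Data.Fin using (Fin; toℕ; fromℕ)
open import Data.Vec using (Vec; []; _∷_; take; drop)
open import Data.List using (List; []; _∷_; map; _++_; upTo)
open import Data.Bool.ListAction using (any)
open import Data.Nat.ListAction using (sum)
open import Data.Product using (Σ; ∃; _×_; _,_)
open import Relation.Binary.PropositionalEquality using (_≡_; _≢_)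
open import Relation.Binary.Construct.Closure.ReflexiveTransitive using (Star)

V : ℕ → Set
V n = Vec Bool n

allV : (n : ℕ) → List (V n)
allV zero = [] ∷ []
allV (suc n) = map (false ∷_) (allV n) ++ map (true ∷_) (allV n)

eqB : Bool → Bool → Bool
eqB true true = true
eqB false false = true
eqB _ _ = false

eqV : {n : ℕ} → V n → V n → Bool
eqV [] [] = true
eqV (a ∷ u) (b ∷ v) = eqB a b ∧ eqV u v

dist : {n : ℕ} → V n → V n → ℕ
dist [] [] = 0
dist (a ∷ u) (b ∷ v) = (if eqB a b then 0 else 1) + dist u v

adj : {n : ℕ} → V n → V n → Bool
adj u v = dist u v ≡ᵇ 1

countᵇ : {A : Set} → (A → Bool) → List A → ℕ
countᵇ P [] = 0
countᵇ P (x ∷ xs) = (if P x then 1 else 0) + countᵇ P xs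

VSet : ℕ → Set
VSet n = V n → Bool

size : (n : ℕ) → VSet n → ℕ
size n A = countᵇ A (allV n)

nbrCount : (n : ℕ) → V n → (V n → Bool) → ℕ
nbrCount n v P = countᵇ (λ w → adj v w ∧ P w) (allV n)

bstep : (n r : ℕ) → VSet n → VSet n
bstep n r A v = A v ∨ (r ≤ᵇ nbrCount n v A)

bIter : (n r : ℕ) → ℕ → VSet n → VSet n
bIter n r zero A = A
bIter n r (suc t) A = bstep n r (bIter n r t A)

Percolates : (n r : ℕ) → VSet n → Set
Percolates n r A = (v : V n) → ∃ λ t → bIter n r t A v ≡ true

IsMinPercSize : (n r m : ℕ) → Set
IsMinPercSize n r m =
  (Σ (VSet n) λ A → Percolates n r A × size n A ≡ m)
  × ((A : VSet n) → Percolates n r A → m ≤ size n A)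

Label : ℕ → ℕ → Set
Label n r = V n → Fin (suc r)

insertDesc : ℕ → List ℕ → List ℕ
insertDesc x [] = x ∷ []
insertDesc x (y ∷ ys) = if y ≤ᵇ x then x ∷ y ∷ ys else y ∷ insertDesc x ys

sortDesc : List ℕ → List ℕ
sortDesc [] = []
sortDesc (x ∷ xs) = insertDesc x (sortDesc xs)

-- k-th element (1-based) of a list, 0 if it does not exist
nth1 : ℕ → List ℕ → ℕ
nth1 _ [] = 0
nth1 zero (x ∷ xs) = 0
nth1 (suc zero) (x ∷ xs) = x
nth1 (suc (suc k)) (x ∷ xs) = nth1 (suc k) xs

nbrLabels : {n r : ℕ} → Label n r → V n → List ℕ
nbrLabels {n} ℓ v = go (allV n)
  where
  go : List (V n) → List ℕ
  go [] = []
  go (w ∷ ws) = if adj v w then toℕ (ℓ w) ∷ go ws else go ws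

rthHighest : {n : ℕ} (r : ℕ) → Label n r → V n → ℕ
rthHighest r ℓ v = nth1 r (sortDesc (nbrLabels ℓ v))

data Rule (n r : ℕ) (ℓ : Label n r) (v : V n) : Fin (suc r) → Set where
  completion : r ∸ toℕ (ℓ v) ≤ nbrCount n v (λ w → toℕ (ℓ w) ≡ᵇ r)
             → Rule n r ℓ v (fromℕ r)
  promotion  : (j : Fin (suc r))
             → r ≤ nbrCount n v (λ w → toℕ (ℓ v) <ᵇ toℕ (ℓ w))
             → toℕ j ≡ rthHighest r ℓ v
             → Rule n r ℓ v j

MetaStep : (n r : ℕ) → Label n r → Label n r → Set
MetaStep n r ℓ ℓ' =
  Σ (V n) λ v → Σ (Fin (suc r)) λ j →
    Rule n r ℓ v j × ℓ' v ≡ j × ((w : V n) → w ≢ v → ℓ' w ≡ ℓ w)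

MetaPercolates : (n r : ℕ) → Label n r → Set
MetaPercolates n r ℓ₀ =
  Σ (Label n r) λ ℓ → Star (MetaStep n r) ℓ₀ ℓ × ((v : V n) → ℓ v ≡ fromℕ r)

range1 : ℕ → List ℕ
range1 r = map suc (upTo r)

-- S^x ⊆ V(Q_{k+n}) : v ∈ S^x iff v = x ++ s with s ∈ S
prefixSet : (k n : ℕ) → V k → VSet n → VSet (k + n)
prefixSet k n x S v = eqV (take k v) x ∧ S (drop k v)

A₀ : (k n r : ℕ) → (ℕ → VSet n) → Label k r → VSet (k + n)
A₀ k n r S ℓ₀ v =
  any (λ i → any (λ x → (toℕ (ℓ₀ x) ≡ᵇ i) ∧ prefixSet k n x (S i) v) (allV k))
      (range1 r)

preimageSize : (k r : ℕ) → Label k r → ℕ → ℕ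
preimageSize k r ℓ₀ i = countᵇ (λ x → toℕ (ℓ₀ x) ≡ᵇ i) (allV k)

bound : (k n r : ℕ) → (ℕ → VSet n) → Label k r → ℕ
bound k n r S ℓ₀ = sum (map (λ i → preimageSize k r ℓ₀ i * size n (S i)) (range1 r))

{-# OPTIONS --safe #-}
module Submission where

-- View Q_{k+n} as Q_k × Q_n, with the fibre {x} × Q_n over each x ∈ Q_k, and run
-- the r-meta process from ℓ₀ alongside the r-neighbour process from A₀.  At every
-- stage of the meta process there is a time after which the fibre over x is fully
-- infected if ℓ x = r, and contains S_{ℓ x} if 1 ≤ ℓ x < r.  Initially the fibres
-- labelled r contain S_r, which r-percolates inside them.  A completion at x of
-- label i gives every point of the fibre r − i infected neighbours in fully infected
-- fibres, so the i-percolating set S_i fills it.  A promotion at x to the r-th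
-- highest neighbouring label j gives every point of S_j an infected neighbour in
-- each of the r fibres over neighbours of label ≥ j, since S_j ⊆ S_j' for
-- j ≤ j' < r.  Once every label is r, everything is infected.  The size bound is
-- the union bound over the pieces S_i^x of A₀.

open import Defs
open import Data.Bool using (Bool; true; false; T; _∧_; _∨_; if_then_else_)
import Data.Bool.Properties as Boolₚ
open import Data.Bool.ListAction using (any)
open import Data.Fin using (Fin; toℕ; fromℕ)
open import Data.Fin.Properties using (toℕ-fromℕ; toℕ≤pred[n])
open import Data.List using (List; []; _∷_; map)
import Data.List as List
open import Data.List.Properties using (map-++; map-∘)
open import Data.List.Membership.Propositional using (_∈_; find; lose)
open import Data.List.Membership.Propositional.Properties using (∈-map⁺; ∈-upTo⁺; ∈-++⁺ˡ; ∈-++⁺ʳ)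
open import Data.List.Relation.Binary.Permutation.Propositional using (_↭_)
open import Data.List.Relation.Binary.Permutation.Propositional.Properties using (map⁺)
open import Data.List.Relation.Unary.Any using (here; there)
open import Data.List.Relation.Unary.Any.Properties using (any⁺; any⁻)
open import Data.List.Relation.Unary.Linked using (Linked; _∷_; tail)
open import Data.Nat using (ℕ; zero; suc; _+_; _*_; _∸_; _≤_; _≥_; _≤ᵇ_; _≡ᵇ_; z≤n; s≤s)
open import Data.Nat.Properties
open import Algebra.Properties.CommutativeSemigroup +-commutativeSemigroup
  using (interchange; x∙yz≈y∙xz)
open import Data.Nat.ListAction using (sum)
open import Data.Nat.ListAction.Properties using (sum-++; sum-↭)
open import Relation.Binary.Properties.DecTotalOrder ≤-decTotalOrder using (≥-decTotalOrder)
open import Data.List.Sort.InsertionSort.Base ≥-decTotalOrder using (insert; sort)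
open import Data.List.Sort.InsertionSort.Properties ≥-decTotalOrder using (sort-↭; sort-↗)
open import Data.Product using (∃; _×_; _,_; proj₁; proj₂)
open import Data.Sum using (_⊎_; inj₁; inj₂)
open import Data.Vec using ([]; _∷_; _++_; take; drop)
open import Data.Vec.Properties using (take++drop≡id; ++-injective; ≡-dec)
open import Function using (_∘_; Equivalence)
open import Relation.Binary.Construct.Closure.ReflexiveTransitive using (Star; ε; _◅_)
open import Relation.Binary.PropositionalEquality
open import Relation.Nullary using (yes; no)

private variable A B C : Set

infix 4 _⊆_
_⊆_ : (A → Bool) → (A → Bool) → Set
P ⊆ Q = ∀ x → P x ≡ true → Q x ≡ true

⊆-trans : {P Q R : A → Bool} → P ⊆ Q → Q ⊆ R → P ⊆ R
⊆-trans P⊆Q Q⊆R x = Q⊆R x ∘ P⊆Q x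

⊆-chain : (P : ℕ → A → Bool) {m : ℕ} → (∀ i → 1 ≤ i → suc i ≤ m → P i ⊆ P (suc i)) →
  ∀ {i} j → 1 ≤ i → i ≤ j → j ≤ m → P i ⊆ P j
⊆-chain P step zero (s≤s z≤n) ()
⊆-chain P step (suc j) 1≤i i≤1+j 1+j≤m with m≤n⇒m<n∨m≡n i≤1+j
... | inj₂ refl = λ _ h → h
... | inj₁ (s≤s i≤j) =
  ⊆-trans (⊆-chain P step j 1≤i i≤j (≤-trans (n≤1+n j) 1+j≤m)) (step j (≤-trans 1≤i i≤j) 1+j≤m)

T⇒≡true : ∀ {b} → T b → b ≡ true
T⇒≡true = Equivalence.to Boolₚ.T-≡

≡true⇒T : ∀ {b} → b ≡ true → T b
≡true⇒T = Equivalence.from Boolₚ.T-≡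

∨-trueˡ : ∀ {a} b → a ≡ true → a ∨ b ≡ true
∨-trueˡ b refl = refl

∨-trueʳ : ∀ a {b} → b ≡ true → a ∨ b ≡ true
∨-trueʳ true  _ = refl
∨-trueʳ false b≡true = b≡true

∨-true⁻ : ∀ a {b} → a ∨ b ≡ true → a ≡ true ⊎ b ≡ true
∨-true⁻ true  _ = inj₁ refl
∨-true⁻ false b≡true = inj₂ b≡true

∧-true⁺ : ∀ {a b} → a ≡ true → b ≡ true → a ∧ b ≡ true
∧-true⁺ refl b≡true = b≡true

∧-true⁻ : ∀ a {b} → a ∧ b ≡ true → a ≡ true × b ≡ true
∧-true⁻ true b≡true = refl , b≡true

∧-⊆ : {P Q : A → Bool} (a : A → Bool) → P ⊆ Q → (λ x → a x ∧ P x) ⊆ (λ x → a x ∧ Q x)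
∧-⊆ a P⊆Q x h with ∧-true⁻ (a x) h
... | ax , Px = ∧-true⁺ ax (P⊆Q x Px)

≤⇒≤ᵇ≡true : ∀ {m n} → m ≤ n → (m ≤ᵇ n) ≡ true
≤⇒≤ᵇ≡true = T⇒≡true ∘ ≤⇒≤ᵇ

≤ᵇ≡true⇒≤ : ∀ m n → (m ≤ᵇ n) ≡ true → m ≤ n
≤ᵇ≡true⇒≤ m n = ≤ᵇ⇒≤ m n ∘ ≡true⇒T

≡ᵇ≡true⇒≡ : ∀ m n → (m ≡ᵇ n) ≡ true → m ≡ n
≡ᵇ≡true⇒≡ m n = ≡ᵇ⇒≡ m n ∘ ≡true⇒T

≡⇒≡ᵇ≡true : ∀ {m n} → m ≡ n → (m ≡ᵇ n) ≡ true
≡⇒≡ᵇ≡true {m} {n} = T⇒≡true ∘ ≡⇒≡ᵇ m n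

any-true⁺ : (p : A → Bool) {x : A} {xs : List A} → x ∈ xs → p x ≡ true → any p xs ≡ true
any-true⁺ p x∈xs px = T⇒≡true (any⁺ p (lose x∈xs (≡true⇒T px)))

any-true⁻ : (p : A → Bool) (xs : List A) → any p xs ≡ true → ∃ λ x → x ∈ xs × p x ≡ true
any-true⁻ p xs h with find (any⁻ p xs (≡true⇒T h))
... | x , x∈xs , px = x , x∈xs , T⇒≡true px

indicator : Bool → ℕ
indicator b = if b then 1 else 0

indicator-mono : ∀ {a b} → (a ≡ true → b ≡ true) → indicator a ≤ indicator b
indicator-mono {false} _ = z≤n
indicator-mono {true} a⇒b rewrite a⇒b refl = ≤-refl

∑ : List A → (A → ℕ) → ℕ
∑ xs f = sum (map f xs)

infix 5 ∑
syntax ∑ xs (λ x → e) = ∑[ x ∈ xs ] e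

countᵇ≡∑ : (P : A → Bool) (xs : List A) → countᵇ P xs ≡ ∑[ x ∈ xs ] indicator (P x)
countᵇ≡∑ P [] = refl
countᵇ≡∑ P (x ∷ xs) = cong (indicator (P x) +_) (countᵇ≡∑ P xs)

∑-cong : {f g : A → ℕ} → (∀ x → f x ≡ g x) → ∀ xs → ∑ xs f ≡ ∑ xs g
∑-cong f≡g [] = refl
∑-cong f≡g (x ∷ xs) = cong₂ _+_ (f≡g x) (∑-cong f≡g xs)

∑-mono-≤ : {f g : A → ℕ} → (∀ x → f x ≤ g x) → ∀ xs → ∑ xs f ≤ ∑ xs g
∑-mono-≤ f≤g [] = z≤n
∑-mono-≤ f≤g (x ∷ xs) = +-mono-≤ (f≤g x) (∑-mono-≤ f≤g xs)

∑-++ : ∀ xs ys (f : A → ℕ) → ∑ (xs List.++ ys) f ≡ ∑ xs f + ∑ ys f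
∑-++ xs ys f = trans (cong sum (map-++ f xs ys)) (sum-++ (map f xs) (map f ys))

∑-map : (g : B → A) (xs : List B) (f : A → ℕ) → ∑ (map g xs) f ≡ ∑ xs (f ∘ g)
∑-map g xs f = cong sum (sym (map-∘ xs))

∑-+ : (f g : A → ℕ) → ∀ xs → ∑[ x ∈ xs ] (f x + g x) ≡ ∑ xs f + ∑ xs g
∑-+ f g [] = refl
∑-+ f g (x ∷ xs) = trans (cong (f x + g x +_) (∑-+ f g xs)) (interchange (f x) (g x) _ _)

∑-zero : (xs : List A) → ∑[ x ∈ xs ] 0 ≡ 0
∑-zero [] = refl
∑-zero (x ∷ xs) = ∑-zero xs

∑-swap : (xs : List A) (ys : List B) (f : A → B → ℕ) →
  ∑[ x ∈ xs ] ∑[ y ∈ ys ] f x y ≡ ∑[ y ∈ ys ] ∑[ x ∈ xs ] f x y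
∑-swap [] ys f = sym (∑-zero ys)
∑-swap (x ∷ xs) ys f =
  trans (cong (∑ ys (f x) +_) (∑-swap xs ys f)) (sym (∑-+ (f x) (λ y → ∑[ x ∈ xs ] f x y) ys))

∑-*ˡ : ∀ c xs (f : A → ℕ) → ∑[ x ∈ xs ] c * f x ≡ c * ∑ xs f
∑-*ˡ c [] f = sym (*-zeroʳ c)
∑-*ˡ c (x ∷ xs) f = trans (cong (c * f x +_) (∑-*ˡ c xs f)) (sym (*-distribˡ-+ c (f x) _))

∑-*ʳ : ∀ c xs (f : A → ℕ) → ∑[ x ∈ xs ] f x * c ≡ ∑ xs f * c
∑-*ʳ c [] f = refl
∑-*ʳ c (x ∷ xs) f = trans (cong (f x * c +_) (∑-*ʳ c xs f)) (sym (*-distribʳ-+ c (f x) _))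

≤∑ : (f : A → ℕ) {x : A} {xs : List A} → x ∈ xs → f x ≤ ∑ xs f
≤∑ f {xs = y ∷ ys} (here refl) = m≤m+n (f y) _
≤∑ f {xs = y ∷ ys} (there x∈ys) = ≤-trans (≤∑ f x∈ys) (m≤n+m _ (f y))

∑-mono-≤-gap : {g h : A → ℕ} {x : A} {xs : List A} → x ∈ xs → g x ≡ 0 → (∀ y → g y ≤ h y) →
  h x + ∑ xs g ≤ ∑ xs h
∑-mono-≤-gap {g = g} {h} {xs = x ∷ ys} (here refl) gx≡0 g≤h =
  subst (λ z → h x + (z + ∑ ys g) ≤ h x + ∑ ys h) (sym gx≡0) (+-monoʳ-≤ (h x) (∑-mono-≤ g≤h ys))
∑-mono-≤-gap {g = g} {h} {x} {y ∷ ys} (there x∈ys) gx≡0 g≤h =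
  subst (_≤ ∑ (y ∷ ys) h) (x∙yz≈y∙xz (g y) (h x) (∑ ys g))
    (+-mono-≤ (g≤h y) (∑-mono-≤-gap x∈ys gx≡0 g≤h))

countᵇ-mono : {P Q : A → Bool} → P ⊆ Q → ∀ xs → countᵇ P xs ≤ countᵇ Q xs
countᵇ-mono {P = P} {Q} P⊆Q xs = begin
  countᵇ P xs                       ≡⟨ countᵇ≡∑ P xs ⟩
  ∑[ x ∈ xs ] indicator (P x)       ≤⟨ ∑-mono-≤ (λ x → indicator-mono (P⊆Q x)) xs ⟩
  ∑[ x ∈ xs ] indicator (Q x)       ≡⟨ countᵇ≡∑ Q xs ⟨
  countᵇ Q xs                       ∎
  where open ≤-Reasoning

countᵇ-↭ : (P : A → Bool) {xs ys : List A} → xs ↭ ys → countᵇ P xs ≡ countᵇ P ys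
countᵇ-↭ P {xs} {ys} xs↭ys = begin
  countᵇ P xs                  ≡⟨ countᵇ≡∑ P xs ⟩
  ∑[ x ∈ xs ] indicator (P x)  ≡⟨ sum-↭ (map⁺ (indicator ∘ P) xs↭ys) ⟩
  ∑[ x ∈ ys ] indicator (P x)  ≡⟨ countᵇ≡∑ P ys ⟨
  countᵇ P ys                  ∎
  where open ≡-Reasoning

∑∑∑-factor : (xs : List A) (ys : List B) (zs : List C) (f : A → C → ℕ) (g : C → B → ℕ) →
  ∑[ x ∈ xs ] ∑[ y ∈ ys ] ∑[ z ∈ zs ] f x z * g z y
    ≡ ∑[ z ∈ zs ] (∑[ x ∈ xs ] f x z) * (∑[ y ∈ ys ] g z y)
∑∑∑-factor {C = C} xs ys zs f g = begin
  ∑[ x ∈ xs ] ∑[ y ∈ ys ] ∑[ z ∈ zs ] f x z * g z y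
    ≡⟨ ∑-cong (λ x → ∑-swap ys zs (λ y z → f x z * g z y)) xs ⟩
  ∑[ x ∈ xs ] ∑[ z ∈ zs ] ∑[ y ∈ ys ] f x z * g z y
    ≡⟨ ∑-cong (λ x → ∑-cong (λ z → ∑-*ˡ (f x z) ys (g z)) zs) xs ⟩
  ∑[ x ∈ xs ] ∑[ z ∈ zs ] f x z * G z
    ≡⟨ ∑-swap xs zs (λ x z → f x z * G z) ⟩
  ∑[ z ∈ zs ] ∑[ x ∈ xs ] f x z * G z
    ≡⟨ ∑-cong (λ z → ∑-*ʳ (G z) xs (λ x → f x z)) zs ⟩
  ∑[ z ∈ zs ] (∑[ x ∈ xs ] f x z) * G z ∎
  where
  open ≡-Reasoning
  G : C → ℕ
  G z = ∑[ y ∈ ys ] g z y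

allV-complete : ∀ {n} (v : V n) → v ∈ allV n
allV-complete [] = here refl
allV-complete {suc n} (false ∷ v) = ∈-++⁺ˡ (∈-map⁺ (false ∷_) (allV-complete v))
allV-complete {suc n} (true ∷ v) = ∈-++⁺ʳ (map (false ∷_) (allV n)) (∈-map⁺ (true ∷_) (allV-complete v))

∑-allV-suc : ∀ n (f : V (suc n) → ℕ) →
  ∑ (allV (suc n)) f ≡ ∑ (allV n) (f ∘ (false ∷_)) + ∑ (allV n) (f ∘ (true ∷_))
∑-allV-suc n f = trans (∑-++ (map (false ∷_) (allV n)) (map (true ∷_) (allV n)) f)
                       (cong₂ _+_ (∑-map (false ∷_) (allV n) f) (∑-map (true ∷_) (allV n) f))

∑-allV-++ : ∀ k n (f : V (k + n) → ℕ) →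
  ∑[ w ∈ allV (k + n) ] f w ≡ ∑[ y ∈ allV k ] ∑[ s ∈ allV n ] f (y ++ s)
∑-allV-++ zero n f = sym (+-identityʳ _)
∑-allV-++ (suc k) n f = begin
  ∑ (allV (suc k + n)) f
    ≡⟨ ∑-allV-suc (k + n) f ⟩
  ∑ (allV (k + n)) (f ∘ (false ∷_)) + ∑ (allV (k + n)) (f ∘ (true ∷_))
    ≡⟨ cong₂ _+_ (∑-allV-++ k n (f ∘ (false ∷_))) (∑-allV-++ k n (f ∘ (true ∷_))) ⟩
  ∑ (allV k) (g ∘ (false ∷_)) + ∑ (allV k) (g ∘ (true ∷_))
    ≡⟨ ∑-allV-suc k g ⟨
  ∑ (allV (suc k)) g ∎
  where
  open ≡-Reasoning
  g : V (suc k) → ℕ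
  g y = ∑[ s ∈ allV n ] f (y ++ s)

take-++ : ∀ {k n} (x : V k) (s : V n) → take k (x ++ s) ≡ x
take-++ {k} x s = proj₁ (++-injective (take k (x ++ s)) x (take++drop≡id k (x ++ s)))

drop-++ : ∀ {k n} (x : V k) (s : V n) → drop k (x ++ s) ≡ s
drop-++ {k} x s = proj₂ (++-injective (take k (x ++ s)) x (take++drop≡id k (x ++ s)))

eqB-refl : ∀ a → eqB a a ≡ true
eqB-refl true = refl
eqB-refl false = refl

eqV-refl : ∀ {n} (x : V n) → eqV x x ≡ true
eqV-refl [] = refl
eqV-refl (a ∷ x) rewrite eqB-refl a = eqV-refl x

eqV⇒≡ : ∀ {n} (x y : V n) → eqV x y ≡ true → x ≡ y
eqV⇒≡ [] [] _ = refl
eqV⇒≡ (true ∷ x) (true ∷ y) h = cong (true ∷_) (eqV⇒≡ x y h)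
eqV⇒≡ (false ∷ x) (false ∷ y) h = cong (false ∷_) (eqV⇒≡ x y h)

dist-refl : ∀ {n} (x : V n) → dist x x ≡ 0
dist-refl [] = refl
dist-refl (a ∷ x) rewrite eqB-refl a = dist-refl x

dist-++ : ∀ {k n} (x y : V k) (s t : V n) → dist (x ++ s) (y ++ t) ≡ dist x y + dist s t
dist-++ [] [] s t = refl
dist-++ (a ∷ x) (b ∷ y) s t =
  trans (cong ((if eqB a b then 0 else 1) +_) (dist-++ x y s t)) (sym (+-assoc _ (dist x y) (dist s t)))

adj-irrefl : ∀ {n} (x : V n) → adj x x ≡ false
adj-irrefl x = cong (_≡ᵇ 1) (dist-refl x)

adj-++ˡ : ∀ {k n} (x y : V k) (s : V n) → adj (x ++ s) (y ++ s) ≡ adj x y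
adj-++ˡ x y s = cong (_≡ᵇ 1) (trans (dist-++ x y s s) (trans (cong (dist x y +_) (dist-refl s)) (+-identityʳ _)))

adj-++ʳ : ∀ {k n} (x : V k) (s t : V n) → adj (x ++ s) (x ++ t) ≡ adj s t
adj-++ʳ x s t = cong (_≡ᵇ 1) (trans (dist-++ x x s t) (cong (_+ dist s t) (dist-refl x)))

bIter-extensive : ∀ n r t {B : VSet n} → B ⊆ bIter n r t B
bIter-extensive n r zero v h = h
bIter-extensive n r (suc t) v h = ∨-trueˡ _ (bIter-extensive n r t v h)

bIter-+ : ∀ n r t u (B : VSet n) → bIter n r t (bIter n r u B) ≡ bIter n r (t + u) B
bIter-+ n r zero u B = refl
bIter-+ n r (suc t) u B = cong (bstep n r) (bIter-+ n r t u B)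

bIter-mono-time : ∀ n r {t u} {B : VSet n} → t ≤ u → bIter n r t B ⊆ bIter n r u B
bIter-mono-time n r {t} {u} {B} t≤u v h =
  subst (λ T → bIter n r T B v ≡ true) (m∸n+n≡m t≤u)
    (subst (λ B′ → B′ v ≡ true) (bIter-+ n r (u ∸ t) t B) (bIter-extensive n r (u ∸ t) v h))

percolation-time : ∀ {n r} {C : VSet n} → Percolates n r C → ∃ λ t → ∀ v → bIter n r t C v ≡ true
percolation-time {n} {r} {C} percolates with uniformly (allV n)
  where
  uniformly : (vs : List (V n)) → ∃ λ t → ∀ {v} → v ∈ vs → bIter n r t C v ≡ true
  uniformly [] = 0 , λ ()
  uniformly (v ∷ vs) with percolates v | uniformly vs
  ... | t , v-in | u , vs-in = t + u , λ where
    (here refl) → bIter-mono-time n r (m≤m+n t u) v v-in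
    (there w∈vs) → bIter-mono-time n r (m≤n+m u t) _ (vs-in w∈vs)
... | t , all-in = t , λ v → all-in (allV-complete v)

module Product (k n : ℕ) where

  fibre : VSet (k + n) → V k → VSet n
  fibre B x s = B (x ++ s)

  crossCount : VSet (k + n) → V k → V n → ℕ
  crossCount B x s = countᵇ (λ y → adj x y ∧ B (y ++ s)) (allV k)

  nbrCount-++ : ∀ B x s → nbrCount n s (fibre B x) + crossCount B x s ≤ nbrCount (k + n) (x ++ s) B
  nbrCount-++ B x s = begin
    nbrCount n s (fibre B x) + crossCount B x s
      ≡⟨ cong₂ _+_ fibre≡ (countᵇ≡∑ _ (allV k)) ⟩
    h x + (∑[ y ∈ allV k ] indicator (adj x y ∧ B (y ++ s)))
      ≤⟨ ∑-mono-≤-gap (allV-complete x) (cong (λ b → indicator (b ∧ B (x ++ s))) (adj-irrefl x)) cross≤h ⟩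
    ∑[ y ∈ allV k ] h y
      ≡⟨ ∑-allV-++ k n F ⟨
    ∑[ w ∈ allV (k + n) ] F w
      ≡⟨ countᵇ≡∑ _ (allV (k + n)) ⟨
    nbrCount (k + n) (x ++ s) B ∎
    where
    open ≤-Reasoning
    F : V (k + n) → ℕ
    F w = indicator (adj (x ++ s) w ∧ B w)
    h : V k → ℕ
    h y = ∑[ t ∈ allV n ] F (y ++ t)
    fibre≡ : nbrCount n s (fibre B x) ≡ h x
    fibre≡ = trans (countᵇ≡∑ _ (allV n))
      (∑-cong (λ t → cong (λ b → indicator (b ∧ B (x ++ t))) (sym (adj-++ʳ x s t))) (allV n))
    cross≤h : ∀ y → indicator (adj x y ∧ B (y ++ s)) ≤ h y
    cross≤h y = subst (_≤ h y) (cong (λ b → indicator (b ∧ B (y ++ s))) (adj-++ˡ x y s))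
      (≤∑ (λ t → F (y ++ t)) (allV-complete s))

  crossCount≤nbrCount : ∀ B x s → crossCount B x s ≤ nbrCount (k + n) (x ++ s) B
  crossCount≤nbrCount B x s = ≤-trans (m≤n+m _ _) (nbrCount-++ B x s)

  bIter-fibre : ∀ {r i} {B : VSet (k + n)} {C : VSet n} x → C ⊆ fibre B x →
    (∀ s → r ∸ i ≤ crossCount B x s) → ∀ t → bIter n i t C ⊆ fibre (bIter (k + n) r t B) x
  bIter-fibre x C⊆B cross zero = C⊆B
  bIter-fibre {r} {i} {B} {C} x C⊆B cross (suc t) s h with ∨-true⁻ (bIter n i t C s) h
  ... | inj₁ old = ∨-trueˡ _ (bIter-fibre x C⊆B cross t s old)
  ... | inj₂ new = ∨-trueʳ _ (≤⇒≤ᵇ≡true (begin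
    r                                              ≤⟨ m≤n+m∸n r i ⟩
    i + (r ∸ i)                                    ≤⟨ +-mono-≤ inside outside ⟩
    nbrCount n s (fibre Bₜ x) + crossCount Bₜ x s  ≤⟨ nbrCount-++ Bₜ x s ⟩
    nbrCount (k + n) (x ++ s) Bₜ                   ∎))
    where
    open ≤-Reasoning
    Bₜ : VSet (k + n)
    Bₜ = bIter (k + n) r t B
    inside : i ≤ nbrCount n s (fibre Bₜ x)
    inside = ≤-trans (≤ᵇ≡true⇒≤ i _ new)
      (countᵇ-mono (∧-⊆ (adj s) (bIter-fibre x C⊆B cross t)) (allV n))
    outside : r ∸ i ≤ crossCount Bₜ x s
    outside = ≤-trans (cross s)
      (countᵇ-mono (∧-⊆ (adj x) (λ y → bIter-extensive (k + n) r t (y ++ s))) (allV k))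

sortDesc≡sort : ∀ L → sortDesc L ≡ sort L
sortDesc≡sort [] = refl
sortDesc≡sort (x ∷ L) rewrite sortDesc≡sort L = insertDesc≡insert (sort L)
  where
  insertDesc≡insert : ∀ L → insertDesc x L ≡ insert x L
  insertDesc≡insert [] = refl
  insertDesc≡insert (y ∷ L) rewrite insertDesc≡insert L = refl

sortDesc-sorted : ∀ L → Linked _≥_ (sortDesc L)
sortDesc-sorted L rewrite sortDesc≡sort L = sort-↗ L

sortDesc-↭ : ∀ L → sortDesc L ↭ L
sortDesc-↭ L rewrite sortDesc≡sort L = sort-↭ L

nth1≤head : ∀ {x M} → Linked _≥_ (x ∷ M) → ∀ m → nth1 m (x ∷ M) ≤ x
nth1≤head _ zero = z≤n
nth1≤head _ (suc zero) = ≤-refl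
nth1≤head {M = []} _ (suc (suc m)) = z≤n
nth1≤head {M = y ∷ M} (x≥y ∷ sorted) (suc (suc m)) = ≤-trans (nth1≤head sorted (suc m)) x≥y

≤nth1⇒≤countᵇ : ∀ {M} → Linked _≥_ M → ∀ r {j} → 1 ≤ j → j ≤ nth1 (suc r) M →
  suc r ≤ countᵇ (j ≤ᵇ_) M
≤nth1⇒≤countᵇ {[]} _ r (s≤s z≤n) ()
≤nth1⇒≤countᵇ {x ∷ M} sorted zero _ j≤x rewrite ≤⇒≤ᵇ≡true j≤x = s≤s z≤n
≤nth1⇒≤countᵇ {x ∷ M} sorted (suc r) 1≤j j≤nth
  rewrite ≤⇒≤ᵇ≡true (≤-trans j≤nth (nth1≤head sorted (suc (suc r)))) =
  s≤s (≤nth1⇒≤countᵇ (tail sorted) r 1≤j j≤nth)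

-- nbrLabels is built from a local function of Defs that cannot be named.  Abstracting
-- over allV n makes its unfolding a pattern, so unification solves neighbourLabels as it.
mutual
  neighbourLabels : ∀ {n r} → Label n r → V n → List (V n) → List ℕ
  neighbourLabels = _

  nbrLabels≡neighbourLabels : ∀ {n r} (ℓ : Label n r) v → nbrLabels ℓ v ≡ neighbourLabels ℓ v (allV n)
  nbrLabels≡neighbourLabels {n} ℓ v with allV n
  ... | vs = refl

countᵇ-neighbourLabels : ∀ {n r} (ℓ : Label n r) v (P : ℕ → Bool) ws →
  countᵇ P (neighbourLabels ℓ v ws) ≡ countᵇ (λ w → adj v w ∧ P (toℕ (ℓ w))) ws
countᵇ-neighbourLabels ℓ v P [] = refl
countᵇ-neighbourLabels ℓ v P (w ∷ ws) with adj v w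
... | true = cong (indicator (P (toℕ (ℓ w))) +_) (countᵇ-neighbourLabels ℓ v P ws)
... | false = countᵇ-neighbourLabels ℓ v P ws

≤rthHighest⇒≤nbrCount : ∀ {n r} (ℓ : Label n r) v {j} → 1 ≤ r → 1 ≤ j → j ≤ rthHighest r ℓ v →
  r ≤ nbrCount n v (λ w → j ≤ᵇ toℕ (ℓ w))
≤rthHighest⇒≤nbrCount {n} {suc r} ℓ v {j} (s≤s z≤n) 1≤j j≤rth = begin
  suc r                                        ≤⟨ ≤nth1⇒≤countᵇ (sortDesc-sorted L) r 1≤j j≤rth ⟩
  countᵇ (j ≤ᵇ_) (sortDesc L)                  ≡⟨ countᵇ-↭ (j ≤ᵇ_) (sortDesc-↭ L) ⟩
  countᵇ (j ≤ᵇ_) L                             ≡⟨ cong (countᵇ (j ≤ᵇ_)) (nbrLabels≡neighbourLabels ℓ v) ⟩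
  countᵇ (j ≤ᵇ_) (neighbourLabels ℓ v (allV n)) ≡⟨ countᵇ-neighbourLabels ℓ v (j ≤ᵇ_) (allV n) ⟩
  nbrCount n v (λ w → j ≤ᵇ toℕ (ℓ w))          ∎
  where
  open ≤-Reasoning
  L : List ℕ
  L = nbrLabels ℓ v

module _ (k n r : ℕ) (S : ℕ → VSet n) (ℓ₀ : Label k r) where

  prefixSet-++ : ∀ x (C : VSet n) (y : V k) s → prefixSet k n x C (y ++ s) ≡ eqV y x ∧ C s
  prefixSet-++ x C y s = cong₂ (λ y′ s′ → eqV y′ x ∧ C s′) (take-++ y s) (drop-++ y s)

  A₀-⊇ : ∀ x s {i} → toℕ (ℓ₀ x) ≡ i → 1 ≤ i → i ≤ r → S i s ≡ true →
    A₀ k n r S ℓ₀ (x ++ s) ≡ true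
  A₀-⊇ x s {suc i} ℓx≡i _ i<r s∈S =
    any-true⁺ _ (∈-map⁺ suc (∈-upTo⁺ i<r)) (any-true⁺ _ (allV-complete x)
      (∧-true⁺ (≡⇒≡ᵇ≡true ℓx≡i)
        (trans (prefixSet-++ x (S (suc i)) x s) (∧-true⁺ (eqV-refl x) s∈S))))

  indicator-A₀ : ∀ y s →
    indicator (A₀ k n r S ℓ₀ (y ++ s))
      ≤ ∑[ i ∈ range1 r ] indicator (toℕ (ℓ₀ y) ≡ᵇ i) * indicator (S i s)
  indicator-A₀ y s with A₀ k n r S ℓ₀ (y ++ s) in y++s∈A₀
  ... | false = z≤n
  ... | true with any-true⁻ _ (range1 r) y++s∈A₀
  ... | i , i∈range , in-layer-i with any-true⁻ _ (allV k) in-layer-i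
  ... | x , _ , in-piece-x with ∧-true⁻ (toℕ (ℓ₀ x) ≡ᵇ i) in-piece-x
  ... | ℓx≡i , y++s∈Sᵢˣ with ∧-true⁻ (eqV y x) (trans (sym (prefixSet-++ x (S i) y s)) y++s∈Sᵢˣ)
  ... | y≈x , s∈S with eqV⇒≡ y x y≈x
  ... | refl = subst (_≤ ∑ (range1 r) term) (cong₂ (λ a b → indicator a * indicator b) ℓx≡i s∈S)
                 (≤∑ term i∈range)
    where
    term : ℕ → ℕ
    term i = indicator (toℕ (ℓ₀ y) ≡ᵇ i) * indicator (S i s)

  size-A₀≤bound : size (k + n) (A₀ k n r S ℓ₀) ≤ bound k n r S ℓ₀
  size-A₀≤bound = begin
    size (k + n) A₀′
      ≡⟨ countᵇ≡∑ A₀′ (allV (k + n)) ⟩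
    ∑[ w ∈ allV (k + n) ] indicator (A₀′ w)
      ≡⟨ ∑-allV-++ k n (indicator ∘ A₀′) ⟩
    ∑[ y ∈ allV k ] ∑[ s ∈ allV n ] indicator (A₀′ (y ++ s))
      ≤⟨ ∑-mono-≤ (λ y → ∑-mono-≤ (indicator-A₀ y) (allV n)) (allV k) ⟩
    ∑[ y ∈ allV k ] ∑[ s ∈ allV n ] ∑[ i ∈ range1 r ] indicator (toℕ (ℓ₀ y) ≡ᵇ i) * indicator (S i s)
      ≡⟨ ∑∑∑-factor (allV k) (allV n) (range1 r)
           (λ y i → indicator (toℕ (ℓ₀ y) ≡ᵇ i)) (λ i s → indicator (S i s)) ⟩
    ∑[ i ∈ range1 r ]
      (∑[ y ∈ allV k ] indicator (toℕ (ℓ₀ y) ≡ᵇ i)) * (∑[ s ∈ allV n ] indicator (S i s))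
      ≡⟨ ∑-cong (λ i → cong₂ _*_ (countᵇ≡∑ _ (allV k)) (countᵇ≡∑ (S i) (allV n))) (range1 r) ⟨
    bound k n r S ℓ₀ ∎
    where
    open ≤-Reasoning
    A₀′ : VSet (k + n)
    A₀′ = A₀ k n r S ℓ₀

module MetaInvariant {r k n : ℕ} (1≤r : 1 ≤ r) (S : ℕ → VSet n)
  (S-percolates : (i : ℕ) → 1 ≤ i → i ≤ r → Percolates n i (S i))
  (S-nested : (i : ℕ) → 1 ≤ i → suc i ≤ r ∸ 1 → S i ⊆ S (suc i)) where

  open Product k n

  Prescribed : ℕ → V n → Set
  Prescribed i s = i ≡ r ⊎ (1 ≤ i × S i s ≡ true)

  Covers : Label k r → VSet (k + n) → Set
  Covers ℓ B = ∀ x s → Prescribed (toℕ (ℓ x)) s → B (x ++ s) ≡ true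

  Reached : Label k r → VSet (k + n) → Set
  Reached ℓ B = ∃ λ t → Covers ℓ (bIter (k + n) r t B)

  Prescribed⇒1≤ : ∀ {i s} → Prescribed i s → 1 ≤ i
  Prescribed⇒1≤ (inj₁ refl) = 1≤r
  Prescribed⇒1≤ (inj₂ (1≤i , _)) = 1≤i

  Prescribed-mono : ∀ {i j s} → i ≤ j → j ≤ r → Prescribed i s → Prescribed j s
  Prescribed-mono i≤j j≤r (inj₁ refl) = inj₁ (≤-antisym j≤r i≤j)
  Prescribed-mono {j = j} i≤j j≤r (inj₂ (1≤i , s∈Sᵢ)) with j ≟ r
  ... | yes j≡r = inj₁ j≡r
  ... | no j≢r = inj₂ (≤-trans 1≤i i≤j ,
    ⊆-chain S S-nested j 1≤i i≤j (∸-monoˡ-≤ 1 (≤∧≢⇒< j≤r j≢r)) _ s∈Sᵢ)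

  fibre-fills : ∀ {B} x i → i ≤ r → (1 ≤ i → S i ⊆ fibre B x) → (∀ s → r ∸ i ≤ crossCount B x s) →
    ∃ λ t → ∀ s → bIter (k + n) r t B (x ++ s) ≡ true
  -- For i = 0 the seed is empty: the 0-neighbour process infects everything in one step.
  fibre-fills {B} x zero _ _ cross =
    1 , λ s → bIter-fibre {r} {0} {B} {λ _ → false} x (λ _ ()) cross 1 s refl
  fibre-fills x (suc i) i≤r seed cross with percolation-time (S-percolates (suc i) (s≤s z≤n) i≤r)
  ... | t , fills = t , λ s → bIter-fibre x (seed (s≤s z≤n)) cross t s (fills s)

  completion-fills : ∀ {ℓ B} v → Covers ℓ B →
    r ∸ toℕ (ℓ v) ≤ nbrCount k v (λ w → toℕ (ℓ w) ≡ᵇ r) →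
    ∃ λ t → ∀ s → bIter (k + n) r t B (v ++ s) ≡ true
  completion-fills {ℓ} {B} v covers enough = fibre-fills v (toℕ (ℓ v)) (toℕ≤pred[n] (ℓ v)) seed cross
    where
    seed : 1 ≤ toℕ (ℓ v) → S (toℕ (ℓ v)) ⊆ fibre B v
    seed 1≤i s s∈S = covers v s (inj₂ (1≤i , s∈S))
    cross : ∀ s → r ∸ toℕ (ℓ v) ≤ crossCount B v s
    cross s = ≤-trans enough (countᵇ-mono (∧-⊆ (adj v)
      (λ w ℓw≡r → covers w s (inj₁ (≡ᵇ≡true⇒≡ _ r ℓw≡r)))) (allV k))

  promotion-covers : ∀ {ℓ B} v (j : Fin (suc r)) → Covers ℓ B → toℕ j ≡ rthHighest r ℓ v →
    ∀ s → Prescribed (toℕ j) s → bIter (k + n) r 1 B (v ++ s) ≡ true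
  promotion-covers {ℓ} {B} v j covers j≡rth s s∈j = ∨-trueʳ (B (v ++ s)) (≤⇒≤ᵇ≡true (begin
    r
      ≤⟨ ≤rthHighest⇒≤nbrCount ℓ v 1≤r (Prescribed⇒1≤ s∈j) (≤-reflexive j≡rth) ⟩
    nbrCount k v (λ w → toℕ j ≤ᵇ toℕ (ℓ w))
      ≤⟨ countᵇ-mono (∧-⊆ (adj v) high⊆B) (allV k) ⟩
    crossCount B v s
      ≤⟨ crossCount≤nbrCount B v s ⟩
    nbrCount (k + n) (v ++ s) B ∎))
    where
    open ≤-Reasoning
    high⊆B : (λ w → toℕ j ≤ᵇ toℕ (ℓ w)) ⊆ (λ w → B (w ++ s))
    high⊆B w j≤ℓw = covers w s (Prescribed-mono (≤ᵇ≡true⇒≤ _ _ j≤ℓw) (toℕ≤pred[n] (ℓ w)) s∈j)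

  rule-covers : ∀ {ℓ B v j} → Covers ℓ B → Rule k r ℓ v j →
    ∃ λ t → ∀ s → Prescribed (toℕ j) s → bIter (k + n) r t B (v ++ s) ≡ true
  rule-covers {v = v} covers (completion enough) with completion-fills v covers enough
  ... | t , fills = t , λ s _ → fills s
  rule-covers {v = v} {j} covers (promotion .j _ j≡rth) = 1 , promotion-covers v j covers j≡rth

  Covers-step : ∀ {ℓ ℓ′ B} → Covers ℓ B → MetaStep k r ℓ ℓ′ → Reached ℓ′ B
  Covers-step {ℓ} {ℓ′} {B} covers (v , j , rule , ℓ′v≡j , unchanged) with rule-covers covers rule
  ... | t , fibre-v = t , covers′
    where
    covers′ : Covers ℓ′ (bIter (k + n) r t B)
    covers′ x s s∈ℓ′x with ≡-dec Boolₚ._≟_ x v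
    ... | yes refl = fibre-v s (subst (λ i → Prescribed (toℕ i) s) ℓ′v≡j s∈ℓ′x)
    ... | no x≢v = bIter-extensive (k + n) r t (x ++ s)
                     (covers x s (subst (λ i → Prescribed (toℕ i) s) (unchanged x x≢v) s∈ℓ′x))

  Reached-star : ∀ {ℓ ℓ′ B} → Star (MetaStep k r) ℓ ℓ′ → Reached ℓ B → Reached ℓ′ B
  Reached-star ε reached = reached
  Reached-star {B = B} (step ◅ steps) (t , covers) with Covers-step covers step
  ... | u , covers′ = Reached-star steps (u + t , subst (Covers _) (bIter-+ (k + n) r u t B) covers′)

  Covers-all-r : ∀ {ℓ B} → (∀ x → ℓ x ≡ fromℕ r) → Covers ℓ B → ∀ v → B v ≡ true
  Covers-all-r {B = B} all-r covers v = subst (λ w → B w ≡ true) (take++drop≡id k v)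
    (covers (take k v) (drop k v) (inj₁ (trans (cong toℕ (all-r (take k v))) (toℕ-fromℕ r))))

  A₀-reached : (ℓ₀ : Label k r) → Reached ℓ₀ (A₀ k n r S ℓ₀)
  A₀-reached ℓ₀ with percolation-time (S-percolates r 1≤r ≤-refl)
  ... | t , Sᵣ-fills = t , covers
    where
    covers : Covers ℓ₀ (bIter (k + n) r t (A₀ k n r S ℓ₀))
    covers x s (inj₁ ℓx≡r) =
      bIter-fibre x (λ s → A₀-⊇ k n r S ℓ₀ x s ℓx≡r 1≤r ≤-refl)
        (λ s → ≤-trans (≤-reflexive (n∸n≡0 r)) z≤n) t s (Sᵣ-fills s)
    covers x s (inj₂ (1≤i , s∈S)) =
      bIter-extensive (k + n) r t (x ++ s) (A₀-⊇ k n r S ℓ₀ x s refl 1≤i (toℕ≤pred[n] (ℓ₀ x)) s∈S)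

  A₀-percolates : (ℓ₀ : Label k r) → MetaPercolates k r ℓ₀ → Percolates (k + n) r (A₀ k n r S ℓ₀)
  A₀-percolates ℓ₀ (_ , steps , all-r) v with Reached-star steps (A₀-reached ℓ₀)
  ... | t , covers = t , Covers-all-r all-r covers v

lemma2p2 : (r k n : ℕ) → 2 ≤ r → 1 ≤ k → r ≤ n
    → (S : ℕ → VSet n) → (ℓ₀ : Label k r)
    → ((i : ℕ) → 1 ≤ i → i ≤ r → Percolates n i (S i))
    → MetaPercolates k r ℓ₀
    → ((i : ℕ) → 1 ≤ i → suc i ≤ r ∸ 1 → (v : V n) → S i v ≡ true → S (suc i) v ≡ true)
    → Percolates (k + n) r (A₀ k n r S ℓ₀)
      × ((m : ℕ) → IsMinPercSize (k + n) r m → m ≤ bound k n r S ℓ₀)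
lemma2p2 r k n 2≤r _ _ S ℓ₀ S-percolates ℓ₀-percolates S-nested =
  percolates , λ m (_ , m-minimal) → ≤-trans (m-minimal _ percolates) (size-A₀≤bound k n r S ℓ₀)
  where
  open MetaInvariant (≤-trans (s≤s z≤n) 2≤r) S S-percolates S-nested
  percolates : Percolates (k + n) r (A₀ k n r S ℓ₀)
  percolates = A₀-percolates ℓ₀ ℓ₀-percolates
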